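{- Let $r>t\geq 2$ and $n\geq 1$ be integers, let $H=K_n^r$ be the complete $r$-uniform hypergraph on $n$ vertices, let $c$ be an edge coloring of $H$ with $l$ colors, and let $G=\Gamma_t(H)$ be the shadow $t$-graph of $H$, equipped with the multi-coloring $c_t^{*}$. Suppose there is a color $i$ and a Hamiltonian tight cycle $C$ in $G$ such that $i\in c_t^{*}(e)$ for every edge $e$ of $C$. Then $H$ contains a Hamiltonian $t$-tight Berge-cycle all of whose edges have the same color under $c$.
   Context: For $r\geq t\geq 2$, an $r$-uniform $t$-tight Berge-cycle of length $n$ in an $r$-uniform hypergraph consists of a sequence of distinct vertices $v_1,\dots,v_n$ (the core sequence) together with distinct edges $e_1,\dots,e_n$ such that $e_j$ contains $v_j,v_{j+1},\dots,v_{j+t-1}$ (indices modulo $n$). It is Hamiltonian if $n$ equals the number of vertices of the hypergraph. The shadow $t$-graph $\Gamma_t(H)$ of an $r$-uniform hypergraph $H$ is the $t$-uniform hypergraph on $V(H)$ whose edges are the $t$-subsets of $V(H)$ contained in some edge of $H$. Given an edge coloring $c$ of $H$, for an edge $e$ of $\Gamma_t(H)$ a color $i$ is called $t$-good for $e$ if at least $r-t+1$ edges of $H$ of color $i$ contain $e$; the multi-coloring $c_t^{*}$ assigns to each edge $e$ of $\Gamma_t(H)$ the set $c_t^{*}(e)$ of all $t$-good colors for $e$. A Hamiltonian tight cycle in a $t$-uniform hypergraph $G$ on $n$ vertices is a cyclic ordering $x_1,\dots,x_n$ of all vertices such that each set $\{x_j,x_{j+1},\dots,x_{j+t-1}\}$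 (indices modulo $n$) is an edge of $G$; these sets are its edges. -}

module Defs where

open import Data.Nat using (ℕ; zero; suc; _+_; _∸_; NonZero)
open import Data.Nat.DivMod using (_mod_)
open import Data.Fin using (Fin; toℕ)
open import Data.Fin.Subset using (Subset; ⁅_⁆; _∪_; ⊥; _⊆_; _∈_; ∣_∣)
open import Data.Product using (Σ; ∃; _×_)
open import Function.Definitions using (Injective)
open import Relation.Binary.PropositionalEquality using (_≡_)

shift : {n : ℕ} .{{_ : NonZero n}} → Fin n → ℕ → Fin n
shift {n} j k = (toℕ j + k) mod n

window : {n : ℕ} .{{_ : NonZero n}} → (Fin n → Fin n) → ℕ → Fin n → Subset n
window x zero    j = ⊥
window x (suc k) j = ⁅ x (shift j k) ⁆ ∪ window x k j

IsEdgeH : {n : ℕ} → (r : ℕ) → Subset n → Set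
IsEdgeH r s = ∣ s ∣ ≡ r

IsEdgeShadow : {n : ℕ} → (r t : ℕ) → Subset n → Set
IsEdgeShadow {n} r t e = ∣ e ∣ ≡ t × Σ (Subset n) (λ s → IsEdgeH r s × e ⊆ s)

Good : {n l : ℕ} → (r t : ℕ) → (c : Subset n → Fin l) → Fin l → Subset n → Set
Good {n} r t c i e =
  Σ (Fin (r ∸ t + 1) → Subset n) λ f →
    Injective _≡_ _≡_ f × (∀ a → IsEdgeH r (f a) × e ⊆ f a × c (f a) ≡ i)

GoodHamTightCycle : {n l : ℕ} .{{_ : NonZero n}} → (r t : ℕ) → (Subset n → Fin l) → Fin l
                  → (Fin n → Fin n) → Set
GoodHamTightCycle r t c i x =
  Injective _≡_ _≡_ x ×
  (∀ j → IsEdgeShadow r t (window x t j) × Good r t c i (window x t j))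

MonoHamBergeCycle : {n l : ℕ} .{{_ : NonZero n}} → (r t : ℕ) → (Subset n → Fin l) → Set
MonoHamBergeCycle {n} {l} r t c =
  Σ (Fin n → Fin n) λ v →
  Σ (Fin n → Subset n) λ E →
  Σ (Fin l) λ col →
    Injective _≡_ _≡_ v ×
    Injective _≡_ _≡_ E ×
    (∀ j → IsEdgeH r (E j)) ×
    (∀ j (k : Fin t) → v (shift j (toℕ k)) ∈ E j) ×
    (∀ j → c (E j) ≡ col)

module Submission where

-- Each window j comes with D = r - t + 1 distinct r-edges of colour i containing it; we must
-- choose one per window, all distinct.  This is a system of distinct representatives, and it
-- exists because no edge contains more than D windows: it is Hall's theorem in the case where
-- every set has D candidates and every candidate serves at most D sets.

open import Defs
open import Data.Nat using (ℕ; zero; suc; _+_; _*_; _∸_; _≤_; _<_; z≤n; s≤s; NonZero; >-nonZero; _%_)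
open import Data.Nat.Properties
open import Data.Fin as Fin using (Fin; zero; suc; toℕ; fromℕ<; inject≤; splitAt; join; remQuot; combine; punchOut)
open import Data.Fin.Properties
  using (any?; toℕ-injective; toℕ<n; toℕ-fromℕ<; injective⇒≤; inject≤-injective; join-splitAt;
         combine-remQuot; punchIn-punchOut)
  renaming (suc-injective to fsuc-injective)
open import Data.Fin.Subset
  using (Subset; _∈_; _∉_; ∣_∣; inside; outside; ⊥; ⊤; ⁅_⁆; _∪_; _─_; _-_; _⊆_; ∁)
open import Data.Fin.Subset.Properties
  using (_∈?_; ∣p∣≤n; ∣p∣≡n⇒p≡⊤; x∈p⇒∣p-x∣<∣p∣; ∣∁p∣≡n∸∣p∣; x∈p⇒x∉∁p; x∈p∪q⁺; x∈p∪q⁻; x∈⁅x⁆; x∈⁅y⁆⇒x≡y;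
         x∈p∧x≢y⇒x∈p-y; p─q⊆p; ∉⊥; p⊆p∪q; ∣⁅x⁆∣≡1; p⊂q⇒∣p∣<∣q∣)
open import Data.Bool.Base using (true)
open import Data.Vec.Base using (_∷_; []; here; there; tabulate)
open import Data.List.Base using (List; []; _∷_; allFin)
open import Data.List.Relation.Unary.Any using () renaming (here to hereₗ; there to thereₗ)
open import Data.List.Membership.Propositional using () renaming (_∈_ to _∈ₗ_)
open import Data.List.Membership.Propositional.Properties using (∈-allFin)
open import Data.Vec.Properties using (lookup∘tabulate; []=⇒lookup; lookup⇒[]=; ≡-dec)
import Data.Bool.Properties as Bool
open import Data.Product using (Σ; ∃; _×_; _,_; proj₁; proj₂; uncurry)
open import Data.Product.Properties using (×-≡,≡→≡)
open import Data.Unit using (tt) renaming (⊤ to Unit)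
open import Data.Sum using (_⊎_; inj₁; inj₂)
open import Data.Empty using (⊥-elim) renaming (⊥ to Empty)
open import Function.Base using (_∘_)
open import Function.Definitions using (Injective)
open import Relation.Nullary using (Dec; yes; no; does; _×-dec_; ¬?)
open import Relation.Unary using (Decidable)
open import Relation.Binary.Definitions using (DecidableEquality)
open import Data.Nat.DivMod using (_mod_; %-distribˡ-+; m%n%n≡m%n; m<n⇒m%n≡m; [m+n]%n≡m%n; m%n<n)
open import Relation.Binary.PropositionalEquality

module Counting where

  record Enumeration {m : ℕ} (s : Subset m) : Set where
    field
      elem           : Fin ∣ s ∣ → Fin m
      elem-injective : Injective _≡_ _≡_ elem
      elem-∈         : ∀ i → elem i ∈ s
      index          : ∀ {x} → x ∈ s → Fin ∣ s ∣
      elem-index     : ∀ {x} (x∈s : x ∈ s) → elem (index x∈s) ≡ x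

  enumerate : {m : ℕ} (s : Subset m) → Enumeration s
  enumerate [] = record { elem = λ () ; elem-injective = λ {i} → λ { } ; elem-∈ = λ ()
                        ; index = λ () ; elem-index = λ () }
  enumerate (outside ∷ s) = record
    { elem = λ i → suc (elem i) ; elem-injective = λ eq → elem-injective (fsuc-injective eq)
    ; elem-∈ = λ i → there (elem-∈ i) ; index = λ { (there x∈s) → index x∈s }
    ; elem-index = λ { (there x∈s) → cong suc (elem-index x∈s) } }
    where open Enumeration (enumerate s)
  enumerate (inside ∷ s) = record
    { elem = elem′ ; elem-injective = injective ; elem-∈ = λ { zero → here ; (suc i) → there (elem-∈ i) }
    ; index = λ { here → zero ; (there x∈s) → suc (index x∈s) }
    ; elem-index = λ { here → refl ; (there x∈s) → cong suc (elem-index x∈s) } }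
    where
    open Enumeration (enumerate s)
    elem′ : Fin (suc ∣ s ∣) → Fin _
    elem′ zero    = zero
    elem′ (suc i) = suc (elem i)
    injective : Injective _≡_ _≡_ elem′
    injective {zero}  {zero}  _  = refl
    injective {suc i} {suc j} eq = cong suc (elem-injective (fsuc-injective eq))

  injection⇒≤∣∣ : {m k : ℕ} (s : Subset m) (h : Fin k → Fin m)
                → Injective _≡_ _≡_ h → (∀ i → h i ∈ s) → k ≤ ∣ s ∣
  injection⇒≤∣∣ s h h-inj h∈s = injective⇒≤ {f = λ i → index (h∈s i)} index-inj
    where
    open Enumeration (enumerate s)
    index-inj : Injective _≡_ _≡_ (λ i → index (h∈s i))
    index-inj {i} {j} eq = h-inj (begin
      h i                   ≡⟨ sym (elem-index (h∈s i)) ⟩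
      elem (index (h∈s i))  ≡⟨ cong elem eq ⟩
      elem (index (h∈s j))  ≡⟨ elem-index (h∈s j) ⟩
      h j                   ∎)
      where open ≡-Reasoning

  disjoint-injections⇒≤∣∣ : {m a b : ℕ} (s : Subset m) (h₁ : Fin a → Fin m) (h₂ : Fin b → Fin m)
    → Injective _≡_ _≡_ h₁ → Injective _≡_ _≡_ h₂ → (∀ i j → h₁ i ≢ h₂ j)
    → (∀ i → h₁ i ∈ s) → (∀ i → h₂ i ∈ s) → a + b ≤ ∣ s ∣
  disjoint-injections⇒≤∣∣ {m} {a} {b} s h₁ h₂ h₁-inj h₂-inj disjoint ∈₁ ∈₂ =
    injection⇒≤∣∣ s (λ z → h (splitAt a z)) h∘split-inj (λ z → h∈s (splitAt a z))
    where
    h : Fin a ⊎ Fin b → Fin m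
    h (inj₁ i) = h₁ i
    h (inj₂ j) = h₂ j
    h-inj : ∀ {u v} → h u ≡ h v → u ≡ v
    h-inj {inj₁ i} {inj₁ j} eq = cong inj₁ (h₁-inj eq)
    h-inj {inj₁ i} {inj₂ j} eq = ⊥-elim (disjoint i j eq)
    h-inj {inj₂ i} {inj₁ j} eq = ⊥-elim (disjoint j i (sym eq))
    h-inj {inj₂ i} {inj₂ j} eq = cong inj₂ (h₂-inj eq)
    h∘split-inj : Injective _≡_ _≡_ (λ z → h (splitAt a z))
    h∘split-inj {z} {w} eq = begin
      z                      ≡⟨ sym (join-splitAt a b z) ⟩
      join a b (splitAt a z) ≡⟨ cong (join a b) (h-inj {splitAt a z} {splitAt a w} eq) ⟩
      join a b (splitAt a w) ≡⟨ join-splitAt a b w ⟩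
      w                      ∎
      where open ≡-Reasoning
    h∈s : ∀ u → h u ∈ s
    h∈s (inj₁ i) = ∈₁ i
    h∈s (inj₂ j) = ∈₂ j

  -- Two different r-subsets of Fin n exist only if r < n; otherwise both are all of Fin n.
  distinct-sets⇒<n : {n r : ℕ} (s s′ : Subset n) → ∣ s ∣ ≡ r → ∣ s′ ∣ ≡ r → s ≢ s′ → r < n
  distinct-sets⇒<n {n} {r} s s′ ∣s∣≡r ∣s′∣≡r s≢s′ with r <? n
  ... | yes r<n = r<n
  ... | no  r≮n = ⊥-elim (s≢s′ (trans (everything s ∣s∣≡r) (sym (everything s′ ∣s′∣≡r))))
    where
    everything : (u : Subset n) → ∣ u ∣ ≡ r → u ≡ ⊤
    everything u ∣u∣≡r = ∣p∣≡n⇒p≡⊤ (≤-antisym (∣p∣≤n u) (subst (n ≤_) (sym ∣u∣≡r) (≮⇒≥ r≮n)))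

  ⟦_⟧ : {m : ℕ} {P : Fin m → Set} → Decidable P → Subset m
  ⟦ P? ⟧ = tabulate (λ x → does (P? x))

  ∈⟦⟧⁺ : {m : ℕ} {P : Fin m → Set} (P? : Decidable P) {x : Fin m} → P x → x ∈ ⟦ P? ⟧
  ∈⟦⟧⁺ {P = P} P? {x} px = lookup⇒[]= x _ (trans (lookup∘tabulate _ x) (is-yes (P? x)))
    where
    is-yes : (d : Dec (P x)) → does d ≡ true
    is-yes (yes _) = refl
    is-yes (no ¬px) = ⊥-elim (¬px px)

  ∈⟦⟧⁻ : {m : ℕ} {P : Fin m → Set} (P? : Decidable P) {x : Fin m} → x ∈ ⟦ P? ⟧ → P x
  ∈⟦⟧⁻ P? {x} x∈ with P? x | trans (sym (lookup∘tabulate (λ y → does (P? y)) x)) ([]=⇒lookup x∈)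
  ... | yes px | _ = px
  ... | no _   | ()

  FibresAtMost : (D : ℕ) {p q : ℕ} → (Fin p → Fin q) → Set
  FibresAtMost D {p} f = ∀ w (g : Fin (suc D) → Fin p) → Injective _≡_ _≡_ g → (∀ k → f (g k) ≡ w) → Empty

  -- Split the domain into the fibre over zero (at most D points) and its complement,
  -- which maps into the remaining q values.
  pigeonhole : (D q : ℕ) {p : ℕ} (f : Fin p → Fin q) → FibresAtMost D f → p ≤ D * q
  pigeonhole D zero {zero}  f fibres = z≤n
  pigeonhole D zero {suc p} f fibres with f zero
  ... | ()
  pigeonhole D (suc q) {p} f fibres = begin
    p                      ≡⟨ sym (m+[n∸m]≡n (∣p∣≤n Z)) ⟩
    ∣ Z ∣ + (p ∸ ∣ Z ∣)    ≡⟨ cong (∣ Z ∣ +_) (sym (∣∁p∣≡n∸∣p∣ Z)) ⟩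
    ∣ Z ∣ + ∣ ∁ Z ∣        ≤⟨ +-mono-≤ ∣Z∣≤D (pigeonhole D q f′ fibres′) ⟩
    D + D * q              ≡⟨ sym (*-suc D q) ⟩
    D * suc q              ∎
    where
    open ≤-Reasoning
    Z : Subset p
    Z = ⟦ (λ i → f i Fin.≟ zero) ⟧
    ∣Z∣≤D : ∣ Z ∣ ≤ D
    ∣Z∣≤D with ∣ Z ∣ ≤? D
    ... | yes le = le
    ... | no gt = ⊥-elim (fibres zero (λ k → elem (inject≤ k (≰⇒> gt)))
                    (λ eq → inject≤-injective _ _ _ _ (elem-injective eq))
                    (λ k → ∈⟦⟧⁻ (λ i → f i Fin.≟ zero) (elem-∈ _)))
      where open Enumeration (enumerate Z)
    open Enumeration (enumerate (∁ Z)) renaming (elem to elem∁; elem-injective to elem∁-inj; elem-∈ to elem∁-∈)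
    nonzero : ∀ i → zero ≢ f (elem∁ i)
    nonzero i eq = x∈p⇒x∉∁p (∈⟦⟧⁺ (λ i → f i Fin.≟ zero) (sym eq)) (elem∁-∈ i)
    f′ : Fin ∣ ∁ Z ∣ → Fin q
    f′ i = punchOut (nonzero i)
    fibres′ : FibresAtMost D f′
    fibres′ w g g-inj g↦w = fibres (suc w) (λ k → elem∁ (g k)) (λ eq → g-inj (elem∁-inj eq))
      (λ k → trans (sym (punchIn-punchOut (nonzero (g k)))) (cong suc (g↦w k)))

-- Each of m indices j (called
-- windows, after the application) has D pairwise distinct candidate blocks F j c, and no block
-- is a candidate of D + 1 different windows.  Then every window can pick one of its candidates so that the picks are pairwise
-- distinct.  (Hall's condition holds by double counting; we prove the conclusion directly by
-- augmenting paths, the counting argument reappearing in `crowded-set-impossible`.)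
module DistinctRepresentatives
  {B : Set} (_≟B_ : DecidableEquality B) {m D : ℕ} (0<D : 0 < D)
  (F : Fin m → Fin D → B) (F-injective : ∀ j → Injective _≡_ _≡_ (F j))
  (degree-bound : ∀ b (g : Fin (suc D) → Fin m) → Injective _≡_ _≡_ g
                → (∀ k → ∃ λ c → F (g k) c ≡ b) → Empty)
  where

  open Counting

  Choice : Set
  Choice = Fin m → Fin D

  pick : Choice → Fin m → B
  pick a x = F x (a x)

  DistinctOn : (Fin m → Set) → Choice → Set
  DistinctOn P a = ∀ {x y} → P x → P y → pick a x ≡ pick a y → x ≡ y

  DistinctOn-mono : ∀ {P Q : Fin m → Set} {a} → (∀ {x} → P x → Q x) → DistinctOn Q a → DistinctOn P a
  DistinctOn-mono P⊆Q distinct px py = distinct (P⊆Q px) (P⊆Q py)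

  Free : Subset m → Choice → Fin m → Fin D → Set
  Free M a j c = ∀ {y} → y ∈ M → F j c ≢ pick a y

  _[_≔_] : Choice → Fin m → Fin D → Choice
  (a [ u ≔ c ]) x with x Fin.≟ u
  ... | yes _ = c
  ... | no  _ = a x

  update-≡ : ∀ a u c → (a [ u ≔ c ]) u ≡ c
  update-≡ a u c with u Fin.≟ u
  ... | yes _ = refl
  ... | no u≢u = ⊥-elim (u≢u refl)

  update-≢ : ∀ a u c {x} → x ≢ u → (a [ u ≔ c ]) x ≡ a x
  update-≢ a u c {x} x≢u with x Fin.≟ u
  ... | yes x≡u = ⊥-elim (x≢u x≡u)
  ... | no  _   = refl

  ∈-∉⇒≢ : ∀ {M : Subset m} {x u} → x ∈ M → u ∉ M → x ≢ u
  ∈-∉⇒≢ x∈M u∉M refl = u∉M x∈M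

  pick-update-∉ : ∀ {M : Subset m} a {u} c {x} → x ∈ M → u ∉ M → pick (a [ u ≔ c ]) x ≡ pick a x
  pick-update-∉ a c {x} x∈M u∉M = cong (F x) (update-≢ a _ c (∈-∉⇒≢ x∈M u∉M))

  pick-update-≡ : ∀ a u c → pick (a [ u ≔ c ]) u ≡ F u c
  pick-update-≡ a u c = cong (F u) (update-≡ a u c)

  add-free : ∀ {M a u c} → DistinctOn (_∈ M) a → u ∉ M → Free M a u c
           → DistinctOn (λ x → x ∈ M ⊎ x ≡ u) (a [ u ≔ c ])
  add-free {a = a} {c = c} distinct u∉M free (inj₁ x∈M) (inj₁ y∈M) eq =
    distinct x∈M y∈M (trans (sym (pick-update-∉ a c x∈M u∉M)) (trans eq (pick-update-∉ a c y∈M u∉M)))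
  add-free distinct u∉M free (inj₂ refl) (inj₂ refl) eq = refl
  add-free {a = a} {u = u} {c = c} distinct u∉M free (inj₁ x∈M) (inj₂ refl) eq =
    ⊥-elim (free x∈M (trans (sym (pick-update-≡ a u c)) (trans (sym eq) (pick-update-∉ a c x∈M u∉M))))
  add-free {a = a} {u = u} {c = c} distinct u∉M free (inj₂ refl) (inj₁ y∈M) eq =
    ⊥-elim (free y∈M (trans (sym (pick-update-≡ a u c)) (trans eq (pick-update-∉ a c y∈M u∉M))))

  -- An alternating path (of length at most s) from window x to window j: from each window one
  -- of its candidates is the pick of the next window, which lies in M and satisfies `ok`.
  data AltPath (M : Subset m) (a : Choice) (ok : Fin m → Set) : ℕ → Fin m → Fin m → Set where
    []   : ∀ {s x} → AltPath M a ok s x x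
    step : ∀ {s x y j} (c : Fin D) → y ∈ M → ok y → F x c ≡ pick a y
         → AltPath M a ok s y j → AltPath M a ok (suc s) x j

  Anywhere : Fin m → Set
  Anywhere _ = Unit

  Avoiding : Fin m → Fin m → Set
  Avoiding w y = y ≢ w

  weaken : ∀ {M a ok s x j} → AltPath M a ok s x j → AltPath M a ok (suc s) x j
  weaken []                  = []
  weaken (step c y∈M oy e p) = step c y∈M oy e (weaken p)

  _∷ʳ_ : ∀ {M a s x z y} → AltPath M a Anywhere s x z
       → (Σ (Fin D) λ c → y ∈ M × F z c ≡ pick a y) → AltPath M a Anywhere (suc s) x y
  []                  ∷ʳ (c , y∈M , e) = step c y∈M tt e []
  step c′ z∈M _ e′ p ∷ʳ last           = step c′ z∈M tt e′ (p ∷ʳ last)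

  after-last-visit : ∀ {M a s x j} w → AltPath M a Anywhere s x j
                   → AltPath M a (Avoiding w) s x j ⊎ AltPath M a (Avoiding w) s w j
  after-last-visit w [] = inj₁ []
  after-last-visit w (step {y = y} c y∈M _ e p) with after-last-visit w p
  ... | inj₂ q = inj₂ (weaken q)
  ... | inj₁ q with y Fin.≟ w
  ...   | yes refl = inj₂ (weaken q)
  ...   | no  y≢w  = inj₁ (step c y∈M y≢w e q)

  avoiding-from : ∀ {M a s j} w → AltPath M a Anywhere s w j → AltPath M a (Avoiding w) s w j
  avoiding-from w p with after-last-visit w p
  ... | inj₁ q = q
  ... | inj₂ q = q

  x∈p─q⇒x∉q : ∀ {n} {x : Fin n} (p q : Subset n) → x ∈ p ─ q → x ∉ q
  x∈p─q⇒x∉q (_ ∷ p) (outside ∷ q) here          = λ ()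
  x∈p─q⇒x∉q (_ ∷ p) (_       ∷ q) (there x∈p─q) = λ { (there x∈q) → x∈p─q⇒x∉q p q x∈p─q x∈q }

  -- Flipping the first edge u →c₀→ w of an alternating path: u (outside M) takes candidate c₀
  -- and joins the matched set, while w leaves it and becomes the new unmatched window.
  module Flip (M : Subset m) (a : Choice) (u w : Fin m) (c₀ : Fin D)
              (u∉M : u ∉ M) (w∈M : w ∈ M) (first : F u c₀ ≡ pick a w) where

    M′ : Subset m
    M′ = (M - w) ∪ ⁅ u ⁆

    a′ : Choice
    a′ = a [ u ≔ c₀ ]

    ∈M′⁺ : ∀ {y} → y ∈ M → y ≢ w → y ∈ M′
    ∈M′⁺ y∈M y≢w = x∈p∪q⁺ (inj₁ (x∈p∧x≢y⇒x∈p-y y∈M y≢w))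

    ∈M′⁻ : ∀ {y} → y ∈ M′ → (y ∈ M × y ≢ w) ⊎ y ≡ u
    ∈M′⁻ {y} y∈M′ with x∈p∪q⁻ (M - w) ⁅ u ⁆ y∈M′
    ... | inj₂ y∈⁅u⁆ = inj₂ (x∈⁅y⁆⇒x≡y u y∈⁅u⁆)
    ... | inj₁ y∈M-w = inj₁ (p─q⊆p M ⁅ w ⁆ y∈M-w , λ { refl → x∈p─q⇒x∉q M ⁅ w ⁆ y∈M-w (x∈⁅x⁆ w) })

    w∉M′ : w ∉ M′
    w∉M′ w∈M′ with ∈M′⁻ w∈M′
    ... | inj₁ (_ , w≢w) = w≢w refl
    ... | inj₂ refl      = u∉M w∈M

    pick′-u : pick a′ u ≡ pick a w
    pick′-u = trans (pick-update-≡ a u c₀) first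

    path′ : ∀ {s x j} → AltPath M a (Avoiding w) s x j → AltPath M′ a′ Anywhere s x j
    path′ []                          = []
    path′ (step c y∈M y≢w e p) = step c (∈M′⁺ y∈M y≢w) tt (trans e (sym (pick-update-∉ a c₀ y∈M u∉M))) (path′ p)

    free′ : ∀ {j c} → Free M a j c → Free M′ a′ j c
    free′ free {y} y∈M′ with ∈M′⁻ y∈M′
    ... | inj₁ (y∈M , _) = λ e → free y∈M (trans e (pick-update-∉ a c₀ y∈M u∉M))
    ... | inj₂ refl      = λ e → free w∈M (trans e pick′-u)

    distinct′ : DistinctOn (_∈ M) a → DistinctOn (_∈ M′) a′
    distinct′ distinct {x} {y} x∈M′ y∈M′ eq with ∈M′⁻ x∈M′ | ∈M′⁻ y∈M′
    ... | inj₁ (x∈M , _) | inj₁ (y∈M , _) = distinct x∈M y∈M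
          (trans (sym (pick-update-∉ a c₀ x∈M u∉M)) (trans eq (pick-update-∉ a c₀ y∈M u∉M)))
    ... | inj₂ refl | inj₂ refl = refl
    ... | inj₂ refl | inj₁ (y∈M , y≢w) = ⊥-elim (y≢w (sym (distinct w∈M y∈M
          (trans (sym pick′-u) (trans eq (pick-update-∉ a c₀ y∈M u∉M))))))
    ... | inj₁ (x∈M , x≢w) | inj₂ refl = ⊥-elim (x≢w (distinct x∈M w∈M
          (trans (sym (pick-update-∉ a c₀ x∈M u∉M)) (trans eq pick′-u))))

    covers : ∀ {x} → x ∈ M ⊎ x ≡ u → x ∈ M′ ⊎ x ≡ w
    covers (inj₂ refl) = inj₁ (x∈p∪q⁺ (inj₂ (x∈⁅x⁆ u)))
    covers {x} (inj₁ x∈M) with x Fin.≟ w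
    ... | yes x≡w = inj₂ x≡w
    ... | no  x≢w = inj₁ (∈M′⁺ x∈M x≢w)

  -- Induction on the length bound: after flipping the
  -- first edge, the rest of the path (cut to avoid w) is an augmenting path for w.
  augment : (s : ℕ) {M : Subset m} {a : Choice} {u j : Fin m} {c : Fin D}
          → DistinctOn (_∈ M) a → u ∉ M → AltPath M a Anywhere s u j → Free M a j c
          → Σ Choice λ a′ → DistinctOn (λ x → x ∈ M ⊎ x ≡ u) a′
  augment s {a = a} {u = u} {c = c} distinct u∉M [] free = a [ u ≔ c ] , add-free distinct u∉M free
  augment (suc s) {M} {a} {u} distinct u∉M (step {y = w} c₀ w∈M _ first p) free
    with augment s (distinct′ distinct) w∉M′ (path′ (avoiding-from w p)) (free′ free)
    where open Flip M a u w c₀ u∉M w∈M first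
  ... | a″ , distinct″ = a″ , DistinctOn-mono covers distinct″
    where open Flip M a u w c₀ u∉M w∈M first

  -- The counting heart of Hall's condition: no set R of windows containing u can have every
  -- candidate of every window of R equal to the pick of a window of R - u.  Indeed, the
  -- ∣ R ∣ * D pairs (window, candidate) would map to the ∣ R ∣ - 1 owners with fibres of size
  -- at most D (pairs with the same owner share a block, so their windows are distinct).
  crowded-set-impossible : (a : Choice) (R : Subset m) {u : Fin m} → u ∈ R
    → (∀ {x} → x ∈ R → ∀ c → ∃ λ y → y ∈ R - u × F x c ≡ pick a y) → Empty
  crowded-set-impossible a R {u} u∈R owner = <-irrefl refl (begin-strict
    ∣ R ∣ * D       ≤⟨ pigeonhole D ∣ R - u ∣ owner-index fibres ⟩
    D * ∣ R - u ∣   <⟨ *-monoʳ-< D {{>-nonZero 0<D}} (x∈p⇒∣p-x∣<∣p∣ u∈R) ⟩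
    D * ∣ R ∣       ≡⟨ *-comm D ∣ R ∣ ⟩
    ∣ R ∣ * D       ∎)
    where
    open ≤-Reasoning
    open Enumeration (enumerate R) using (elem; elem-injective; elem-∈)
    open Enumeration (enumerate (R - u)) using () renaming (elem to elem⁻; index to index⁻; elem-index to elem-index⁻)
    window-of : Fin (∣ R ∣ * D) → Fin m
    window-of z = elem (proj₁ (remQuot {∣ R ∣} D z))
    candidate : Fin (∣ R ∣ * D) → Fin D
    candidate z = proj₂ (remQuot {∣ R ∣} D z)
    owner-of : ∀ z → ∃ λ y → y ∈ R - u × F (window-of z) (candidate z) ≡ pick a y
    owner-of z = owner (elem-∈ (proj₁ (remQuot {∣ R ∣} D z))) (candidate z)
    owner-index : Fin (∣ R ∣ * D) → Fin ∣ R - u ∣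
    owner-index z = index⁻ (proj₁ (proj₂ (owner-of z)))
    -- A pair is determined by its window-of once the block it hits is fixed.
    block : ∀ z → F (window-of z) (candidate z) ≡ pick a (elem⁻ (owner-index z))
    block z = trans (proj₂ (proj₂ (owner-of z))) (cong (pick a) (sym (elem-index⁻ (proj₁ (proj₂ (owner-of z))))))
    fibres : FibresAtMost D owner-index
    fibres w g g-inj g↦w = degree-bound (pick a (elem⁻ w)) (window-of ∘ g) windows-distinct
      (λ k → candidate (g k) , shares k)
      where
      shares : ∀ k → F (window-of (g k)) (candidate (g k)) ≡ pick a (elem⁻ w)
      shares k = trans (block (g k)) (cong (pick a ∘ elem⁻) (g↦w k))
      windows-distinct : Injective _≡_ _≡_ (window-of ∘ g)
      windows-distinct {k} {k′} eq = g-inj (trans (sym (combine-remQuot {∣ R ∣} D (g k)))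
        (trans (cong (uncurry combine) (×-≡,≡→≡ (elem-injective eq , same-candidate)))
               (combine-remQuot {∣ R ∣} D (g k′))))
        where
        same-candidate : candidate (g k) ≡ candidate (g k′)
        same-candidate = F-injective (window-of (g k))
          (trans (shares k) (trans (sym (shares k′)) (cong (λ v → F v (candidate (g k′))) (sym eq))))

  module Search (M : Subset m) (a : Choice) (u : Fin m) (u∉M : u ∉ M) where

    Reached : Subset m → Fin m → Set
    Reached R y = y ∈ M × ∃ λ x → x ∈ R × ∃ λ c → F x c ≡ pick a y

    reached? : ∀ R → Decidable (Reached R)
    reached? R y = (y ∈? M) ×-dec any? (λ x → (x ∈? R) ×-dec any? (λ c → F x c ≟B pick a y))

    layer : ℕ → Subset m
    layer zero    = ⁅ u ⁆
    layer (suc s) = layer s ∪ ⟦ reached? (layer s) ⟧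

    path-to : ∀ s {y} → y ∈ layer s → AltPath M a Anywhere s u y
    path-to zero y∈ with x∈⁅y⁆⇒x≡y u y∈
    ... | refl = []
    path-to (suc s) {y} y∈ with x∈p∪q⁻ (layer s) _ y∈
    ... | inj₁ y∈layer = weaken (path-to s y∈layer)
    ... | inj₂ y∈new with ∈⟦⟧⁻ (reached? (layer s)) y∈new
    ...   | y∈M , x , x∈layer , c , e = path-to s x∈layer ∷ʳ (c , y∈M , e)

    u∈layer : ∀ s → u ∈ layer s
    u∈layer zero    = x∈⁅x⁆ u
    u∈layer (suc s) = p⊆p∪q _ (u∈layer s)

    AugmentingPath : Set
    AugmentingPath = Σ ℕ λ s → Σ (Fin m) λ j → Σ (Fin D) λ c → AltPath M a Anywhere s u j × Free M a j c

    free-or-owned : ∀ j c → Free M a j c ⊎ (∃ λ y → y ∈ M × F j c ≡ pick a y)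
    free-or-owned j c with any? (λ y → (y ∈? M) ×-dec (F j c ≟B pick a y))
    ... | yes owned = inj₂ owned
    ... | no ¬owned = inj₁ (λ {y} y∈M e → ¬owned (y , y∈M , e))

    free? : ∀ j c → Dec (Free M a j c)
    free? j c with free-or-owned j c
    ... | inj₁ free           = yes free
    ... | inj₂ (y , y∈M , e) = no (λ free → free y∈M e)

    -- If the layers stop growing, some window of the last layer has a free candidate: otherwise
    -- every candidate is owned by a window of the layer other than u, a crowded set.
    closed⇒augmenting : ∀ s → layer (suc s) ⊆ layer s → AugmentingPath
    closed⇒augmenting s closed with any? (λ x → (x ∈? layer s) ×-dec any? (λ c → free? x c))
    ... | yes (x , x∈layer , c , free) = s , x , c , path-to s x∈layer , free
    ... | no ¬free = ⊥-elim (crowded-set-impossible a (layer s) (u∈layer s) owner)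
      where
      owner : ∀ {x} → x ∈ layer s → ∀ c → ∃ λ y → y ∈ layer s - u × F x c ≡ pick a y
      owner {x} x∈layer c with free-or-owned x c
      ... | inj₁ free           = ⊥-elim (¬free (x , x∈layer , c , free))
      ... | inj₂ (y , y∈M , e) =
        y , x∈p∧x≢y⇒x∈p-y (closed (x∈p∪q⁺ (inj₂ (∈⟦⟧⁺ (reached? (layer s)) (y∈M , x , x∈layer , c , e)))))
                          (∈-∉⇒≢ y∈M u∉M) , e

    growth : ∀ s → AugmentingPath ⊎ s < ∣ layer s ∣
    growth zero = inj₂ (subst (0 <_) (sym (∣⁅x⁆∣≡1 u)) (s≤s z≤n))
    growth (suc s) with growth s
    ... | inj₁ found = inj₁ found
    ... | inj₂ s<∣layer∣ with any? (λ y → (y ∈? layer (suc s)) ×-dec ¬? (y ∈? layer s))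
    ...   | yes (y , y∈next , y∉layer) =
      inj₂ (<-≤-trans (s≤s s<∣layer∣) (p⊂q⇒∣p∣<∣q∣ (p⊆p∪q _ , y , y∈next , y∉layer)))
    ...   | no ¬new = inj₁ (closed⇒augmenting s closed)
      where
      closed : layer (suc s) ⊆ layer s
      closed {y} y∈next with y ∈? layer s
      ... | yes y∈layer = y∈layer
      ... | no  y∉layer = ⊥-elim (¬new (y , y∈next , y∉layer))

    augmenting-path : AugmentingPath
    augmenting-path with growth m
    ... | inj₁ found = found
    ... | inj₂ m<∣layer∣ = ⊥-elim (<-irrefl refl (<-≤-trans m<∣layer∣ (∣p∣≤n (layer m))))

  extend : ∀ {M a u} → DistinctOn (_∈ M) a → u ∉ M → Σ Choice λ a′ → DistinctOn (_∈ M ∪ ⁅ u ⁆) a′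
  extend {M} {a} {u} distinct u∉M with Search.augmenting-path M a u u∉M
  ... | s , j , c , path , free with augment s distinct u∉M path free
  ...   | a′ , distinct′ = a′ , DistinctOn-mono split distinct′
    where
    split : ∀ {x} → x ∈ M ∪ ⁅ u ⁆ → x ∈ M ⊎ x ≡ u
    split {x} x∈ with x∈p∪q⁻ M ⁅ u ⁆ x∈
    ... | inj₁ x∈M  = inj₁ x∈M
    ... | inj₂ x∈⁅u⁆ = inj₂ (x∈⁅y⁆⇒x≡y u x∈⁅u⁆)

  cover : (L : List (Fin m))
        → Σ (Subset m) λ M → Σ Choice λ a → DistinctOn (_∈ M) a × (∀ {x} → x ∈ₗ L → x ∈ M)
  cover [] = ⊥ , (λ _ → fromℕ< 0<D) , (λ x∈⊥ → ⊥-elim (∉⊥ x∈⊥)) , λ ()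
  cover (v ∷ L) with cover L
  ... | M , a , distinct , L⊆M with v ∈? M
  ...   | yes v∈M = M , a , distinct , λ { (hereₗ refl) → v∈M ; (thereₗ x∈L) → L⊆M x∈L }
  ...   | no  v∉M with extend distinct v∉M
  ...     | a′ , distinct′ = M ∪ ⁅ v ⁆ , a′ , distinct′ ,
            λ { (hereₗ refl) → x∈p∪q⁺ (inj₂ (x∈⁅x⁆ v)) ; (thereₗ x∈L) → x∈p∪q⁺ (inj₁ (L⊆M x∈L)) }

  distinct-representatives : Σ Choice λ a → Injective _≡_ _≡_ (pick a)
  distinct-representatives with cover (allFin m)
  ... | M , a , distinct , all⊆M = a , λ {x} {y} → distinct (all⊆M (∈-allFin x)) (all⊆M (∈-allFin y))

argmax : {k : ℕ} (f : Fin (suc k) → ℕ) → ∃ λ i → ∀ j → f j ≤ f i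
argmax {zero}  f = zero , λ { zero → ≤-refl }
argmax {suc k} f with argmax (λ j → f (suc j))
... | i , max with f zero ≤? f (suc i)
...   | yes f0≤ = suc i , λ { zero → f0≤ ; (suc j) → max j }
...   | no  f0≰ = zero  , λ { zero → ≤-refl ; (suc j) → ≤-trans (max j) (<⇒≤ (≰⇒> f0≰)) }

[m%n+k]%n≡[m+k]%n : ∀ m k n .{{_ : NonZero n}} → (m % n + k) % n ≡ (m + k) % n
[m%n+k]%n≡[m+k]%n m k n = begin
  (m % n + k) % n            ≡⟨ %-distribˡ-+ (m % n) k n ⟩
  (m % n % n + k % n) % n    ≡⟨ cong (λ z → (z + k % n) % n) (m%n%n≡m%n m n) ⟩
  (m % n + k % n) % n        ≡⟨ sym (%-distribˡ-+ m k n) ⟩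
  (m + k) % n                ∎
  where open ≡-Reasoning

module CyclicWindows {n : ℕ} .{{_ : NonZero n}} (x : Fin n → Fin n) (x-injective : Injective _≡_ _≡_ x) where

  ∈window : ∀ t j {k} → k < t → x (shift j k) ∈ window x t j
  ∈window (suc t) j {k} k<t with m≤n⇒m<n∨m≡n (≤-pred k<t)
  ... | inj₁ k<t′ = x∈p∪q⁺ (inj₂ (∈window t j k<t′))
  ... | inj₂ refl = x∈p∪q⁺ (inj₁ (x∈⁅x⁆ _))

  -- Positions measured so that a chosen position p becomes the last one, n - 1.
  module PositionsEndingAt (p : Fin n) where

    offset : ℕ
    offset = n ∸ suc (toℕ p)

    last : ℕ
    last = toℕ p + offset

    suc-last : suc last ≡ n
    suc-last = m+[n∸m]≡n (toℕ<n p)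

    pos : Fin n → ℕ
    pos q = (toℕ q + offset) % n

    last<n : last < n
    last<n = subst (last <_) suc-last ≤-refl

    pos-p : pos p ≡ last
    pos-p = m<n⇒m%n≡m last<n

    -- Adding p + 1 undoes the offset, so pos is injective.
    pos-inverse : ∀ q → (pos q + suc (toℕ p)) % n ≡ toℕ q
    pos-inverse q = begin
      (pos q + suc (toℕ p)) % n             ≡⟨ [m%n+k]%n≡[m+k]%n (toℕ q + offset) (suc (toℕ p)) n ⟩
      (toℕ q + offset + suc (toℕ p)) % n    ≡⟨ cong (_% n) (+-assoc (toℕ q) offset (suc (toℕ p))) ⟩
      (toℕ q + (offset + suc (toℕ p))) % n  ≡⟨ cong (λ z → (toℕ q + z) % n) (trans (+-comm offset _) suc-last) ⟩
      (toℕ q + n) % n                       ≡⟨ [m+n]%n≡m%n (toℕ q) n ⟩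
      toℕ q % n                             ≡⟨ m<n⇒m%n≡m (toℕ<n q) ⟩
      toℕ q                                 ∎
      where open ≡-Reasoning

    pos-injective : ∀ {q q′} → pos q ≡ pos q′ → q ≡ q′
    pos-injective {q} {q′} eq = toℕ-injective
      (trans (sym (pos-inverse q)) (trans (cong (λ z → (z + suc (toℕ p)) % n) eq) (pos-inverse q′)))

    pos-shift : ∀ j k → pos (shift j k) ≡ (pos j + k) % n
    pos-shift j k = begin
      (toℕ (shift j k) + offset) % n   ≡⟨ cong (λ z → (z + offset) % n) (toℕ-fromℕ< (m%n<n (toℕ j + k) n)) ⟩
      ((toℕ j + k) % n + offset) % n   ≡⟨ [m%n+k]%n≡[m+k]%n (toℕ j + k) offset n ⟩
      (toℕ j + k + offset) % n         ≡⟨ cong (_% n) (+-assoc (toℕ j) k offset) ⟩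
      (toℕ j + (k + offset)) % n       ≡⟨ cong (λ z → (toℕ j + z) % n) (+-comm k offset) ⟩
      (toℕ j + (offset + k)) % n       ≡⟨ cong (_% n) (sym (+-assoc (toℕ j) offset k)) ⟩
      (toℕ j + offset + k) % n         ≡⟨ sym ([m%n+k]%n≡[m+k]%n (toℕ j + offset) k n) ⟩
      (pos j + k) % n                  ∎
      where open ≡-Reasoning

    no-wrap : ∀ t j → x p ∉ window x t j → ∀ k → k < t → pos j + k < last
    no-wrap t j p∉ k k<t = ≤∧≢⇒< (≤last k k<t) ≢last
      where
      ≤last : ∀ k → k < t → pos j + k ≤ last
      ≤last zero    _   = ≤-pred (subst₂ _<_ (sym (+-identityʳ (pos j))) (sym suc-last) (m%n<n (toℕ j + offset) n))
      ≤last (suc k) k<t = subst (_≤ last) (sym (+-suc (pos j) k)) (no-wrap t j p∉ k (<-trans (n<1+n k) k<t))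
      ≢last : pos j + k ≢ last
      ≢last eq = p∉ (subst (λ q → x q ∈ window x t j)
        (pos-injective (trans (pos-shift j k) (trans (m<n⇒m%n≡m (≤-<-trans (≤last k k<t) last<n)) (trans eq (sym pos-p)))))
        (∈window t j k<t))

    pos-window : ∀ t j → x p ∉ window x t j → ∀ k → k < t → pos (shift j k) ≡ pos j + k
    pos-window t j p∉ k k<t =
      trans (pos-shift j k) (m<n⇒m%n≡m (<-trans (no-wrap t j p∉ k k<t) last<n))

  position-outside : (E : Subset n) → ∣ E ∣ < n → ∃ λ p → x p ∉ E
  position-outside E ∣E∣<n with any? (λ p → ¬? (x p ∈? E))
  ... | yes found = found
  ... | no ¬outside = ⊥-elim (<⇒≱ ∣E∣<n (injection⇒≤∣∣ E x x-injective all-inside))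
    where
    open Counting using (injection⇒≤∣∣)
    all-inside : ∀ q → x q ∈ E
    all-inside q with x q ∈? E
    ... | yes x∈E = x∈E
    ... | no  x∉E = ⊥-elim (¬outside (q , x∉E))

  -- Measure positions so that a vertex outside E comes last; then no window inside E wraps
  -- around.  The r - t + 2 starting vertices, together with the t - 1 further vertices of the
  -- window starting furthest along, are r + 1 distinct vertices of E.
  few-windows-inside : ∀ t r → 1 ≤ t → t ≤ r → (E : Subset n) → ∣ E ∣ ≡ r → r < n
    → (g : Fin (suc (r ∸ t + 1)) → Fin n) → Injective _≡_ _≡_ g → (∀ k → window x t (g k) ⊆ E) → Empty
  few-windows-inside t r 1≤t t≤r E ∣E∣≡r r<n g g-inj within
    with position-outside E (subst (_< n) (sym ∣E∣≡r) r<n)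
  ... | p , p∉E = <-irrefl refl (begin-strict
    r                          ≡⟨ sym (trans (+-assoc (r ∸ t) 1 (t ∸ 1)) (trans (cong (r ∸ t +_) (m+[n∸m]≡n 1≤t)) (m∸n+n≡m t≤r))) ⟩
    r ∸ t + 1 + (t ∸ 1)        <⟨ ≤-refl ⟩
    suc (r ∸ t + 1) + (t ∸ 1)  ≤⟨ disjoint-injections⇒≤∣∣ E first tail first-inj tail-inj first≢tail first∈E tail∈E ⟩
    ∣ E ∣                      ≡⟨ ∣E∣≡r ⟩
    r                          ∎)
    where
    open ≤-Reasoning
    open Counting using (disjoint-injections⇒≤∣∣)
    open PositionsEndingAt p
    avoids : ∀ k → x p ∉ window x t (g k)
    avoids k = p∉E ∘ within k
    furthest : Fin (suc (r ∸ t + 1))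
    furthest = proj₁ (argmax (pos ∘ g))
    first : Fin (suc (r ∸ t + 1)) → Fin n
    first k = x (shift (g k) 0)
    tail-offset : Fin (t ∸ 1) → ℕ
    tail-offset i = suc (toℕ i)
    tail-offset<t : ∀ i → tail-offset i < t
    tail-offset<t i = subst (tail-offset i <_) (trans (+-comm 1 (t ∸ 1)) (m∸n+n≡m 1≤t)) (s≤s (toℕ<n i))
    tail : Fin (t ∸ 1) → Fin n
    tail i = x (shift (g furthest) (tail-offset i))
    pos-first : ∀ k → pos (shift (g k) 0) ≡ pos (g k)
    pos-first k = trans (pos-window t (g k) (avoids k) 0 1≤t) (+-identityʳ _)
    pos-tail : ∀ i → pos (shift (g furthest) (tail-offset i)) ≡ pos (g furthest) + tail-offset i
    pos-tail i = pos-window t (g furthest) (avoids furthest) (tail-offset i) (tail-offset<t i)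
    first-inj : Injective _≡_ _≡_ first
    first-inj {k} {k′} eq = g-inj (pos-injective (trans (sym (pos-first k)) (trans (cong pos (x-injective eq)) (pos-first k′))))
    tail-inj : Injective _≡_ _≡_ tail
    tail-inj {i} {i′} eq = toℕ-injective (suc-injective (+-cancelˡ-≡ (pos (g furthest)) _ _
      (trans (sym (pos-tail i)) (trans (cong pos (x-injective eq)) (pos-tail i′)))))
    -- Every first is at or before the furthest first, every tail vertex strictly after it.
    first≢tail : ∀ k i → first k ≢ tail i
    first≢tail k i eq = <⇒≱ (m<m+n (pos (g furthest)) (s≤s z≤n)) (begin
      pos (g furthest) + tail-offset i  ≡⟨ sym (pos-tail i) ⟩
      pos (shift (g furthest) (tail-offset i)) ≡⟨ cong pos (x-injective eq) ⟨
      pos (shift (g k) 0)               ≡⟨ pos-first k ⟩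
      pos (g k)                         ≤⟨ proj₂ (argmax (pos ∘ g)) k ⟩
      pos (g furthest)                  ∎)
    first∈E : ∀ k → first k ∈ E
    first∈E k = within k (∈window t (g k) 1≤t)
    tail∈E : ∀ i → tail i ∈ E
    tail∈E i = within furthest (∈window t (g furthest) (tail-offset<t i))

module GoodColour {n l r t : ℕ} {c : Subset n → Fin l} {i : Fin l} {e : Subset n}
                  (good : Good r t c i e) where

  edge : Fin (r ∸ t + 1) → Subset n
  edge = proj₁ good

  edge-injective : Injective _≡_ _≡_ edge
  edge-injective = proj₁ (proj₂ good)

  size : ∀ d → ∣ edge d ∣ ≡ r
  size d = proj₁ (proj₂ (proj₂ good) d)

  ⊆edge : ∀ d → e ⊆ edge d
  ⊆edge d = proj₁ (proj₂ (proj₂ (proj₂ good) d))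

  colour : ∀ d → c (edge d) ≡ i
  colour d = proj₂ (proj₂ (proj₂ (proj₂ good) d))

  -- For t < r there are two different such edges, which forces r < n.
  r<n : t < r → r < n
  r<n t<r = distinct-sets⇒<n (edge d₀) (edge d₁) (size d₀) (size d₁) (d₀≢d₁ ∘ edge-injective)
    where
    open Counting using (distinct-sets⇒<n)
    1<D : 1 < r ∸ t + 1
    1<D = subst (1 <_) (+-comm 1 (r ∸ t)) (s≤s (m<n⇒0<n∸m t<r))
    d₀ d₁ : Fin (r ∸ t + 1)
    d₀ = fromℕ< (<-trans (s≤s z≤n) 1<D)
    d₁ = fromℕ< 1<D
    d₀≢d₁ : d₀ ≢ d₁
    d₀≢d₁ eq with trans (sym (toℕ-fromℕ< (<-trans (s≤s z≤n) 1<D))) (trans (cong toℕ eq) (toℕ-fromℕ< 1<D))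
    ... | ()

-- Each window has r - t + 1 distinct edges of
-- colour i containing it, and an edge contains at most r - t + 1 windows; so the windows have
-- distinct representatives, which with the core sequence x form a monochromatic Berge cycle.
lemma2p1 : (r t n l : ℕ) → 2 ≤ t → t < r → .{{_ : NonZero n}}
         → (c : Subset n → Fin l)
         → Σ (Fin l) (λ i → Σ (Fin n → Fin n) (λ x → GoodHamTightCycle r t c i x))
         → MonoHamBergeCycle r t c
lemma2p1 r t n l 2≤t t<r c (i , x , x-injective , cycle) =
  x , (λ j → edge j (a j)) , i , x-injective , edges-distinct ,
  (λ j → size j (a j)) , (λ j k → ⊆edge j (a j) (∈window t j (toℕ<n k))) , (λ j → colour j (a j))
  where
  open CyclicWindows x x-injective
  open module GoodWindow (j : Fin n) = GoodColour {t = t} {c = c} (proj₂ (cycle j))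
  degree-bound : ∀ b (g : Fin (suc (r ∸ t + 1)) → Fin n) → Injective _≡_ _≡_ g
               → (∀ k → ∃ λ d → edge (g k) d ≡ b) → Empty
  degree-bound b g g-inj shared = few-windows-inside t r (≤-trans (s≤s z≤n) 2≤t) (<⇒≤ t<r) b
    (subst (λ e → ∣ e ∣ ≡ r) (proj₂ (shared zero)) (size (g zero) (proj₁ (shared zero))))
    (r<n (0 mod n) t<r) g g-inj
    (λ k → subst (window x t (g k) ⊆_) (proj₂ (shared k)) (⊆edge (g k) (proj₁ (shared k))))
  open DistinctRepresentatives (≡-dec Bool._≟_) (subst (0 <_) (+-comm 1 (r ∸ t)) (s≤s z≤n))
    edge edge-injective degree-bound
  a : Fin n → Fin (r ∸ t + 1)
  a = proj₁ distinct-representatives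
  edges-distinct : Injective _≡_ _≡_ (λ j → edge j (a j))
  edges-distinct = proj₂ distinct-representatives
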